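{- Let $n \geq 4$ and let $G$ be an $n$-vertex $2$-connected graph. Let $v \in V(G)$ and $W(v) := \{ w \in N(v) : N[v] \not\subseteq N[w] \}$. If $W(v) \neq \emptyset$, then there is $w \in W(v)$ such that $G/vw$ is $2$-connected.
   Context: $N(v)$ is the neighborhood of $v$ and $N[v] = N(v) \cup \{v\}$. For an edge $xy$, $G/xy$ is the simple graph obtained by contracting $xy$: $x$ and $y$ are replaced by a single new vertex adjacent to all vertices of $(N(x) \cup N(y)) \setminus \{x,y\}$. -}

module Defs where

open import Data.Nat using (ℕ; suc; _≤_)
open import Data.Fin using (Fin; punchIn)
open import Data.Product using (_×_; Σ; ∃)
open import Data.Sum using (_⊎_)
open import Relation.Nullary using (¬_)
open import Relation.Binary.PropositionalEquality using (_≡_; _≢_)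
open import Relation.Binary.Core using (Rel)
open import Relation.Binary.Definitions using (Decidable; Symmetric; Irreflexive)

record SimpleGraph (n : ℕ) : Set₁ where
  field
    Adj    : Rel (Fin n) _
    adj?   : Decidable Adj
    sym    : Symmetric Adj
    irrefl : Irreflexive _≡_ Adj
open SimpleGraph public

data Walk {n : ℕ} (R : Rel (Fin n) _) (P : Fin n → Set) : Fin n → Fin n → Set where
  [_]  : ∀ {u} → P u → Walk R P u u
  _∷_ : ∀ {u x v} → P u × R u x → Walk R P x v → Walk R P u v

ConnectedOn : {n : ℕ} → Rel (Fin n) _ → (Fin n → Set) → Set
ConnectedOn R P = ∀ u v → P u → P v → Walk R P u v

TwoConnected : {n : ℕ} → Rel (Fin n) _ → Set
TwoConnected {n} R = 3 ≤ n × (∀ x → ConnectedOn R (λ y → y ≢ x))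

N[_] : {n : ℕ} → SimpleGraph n → Fin n → Fin n → Set
N[ G ] x u = u ≡ x ⊎ Adj G x u

NSub : {n : ℕ} → SimpleGraph n → Fin n → Fin n → Set
NSub G v w = ∀ u → N[ G ] v u → N[ G ] w u

InW : {n : ℕ} → SimpleGraph n → Fin n → Fin n → Set
InW G v w = Adj G v w × ¬ (NSub G v w)

-- Contraction G/vw (for v ≠ w), as a graph on Fin m where n = suc m:
-- vertex i of G/vw is vertex (punchIn w i) of G, i.e. w is deleted and
-- v plays the role of the new merged vertex, adjacent to all of
-- (N(v) ∪ N(w)) ∖ {v, w}; other adjacencies are as in G.
Contract : {m : ℕ} → SimpleGraph (suc m) → Fin (suc m) → Fin (suc m) → Rel (Fin m) _
Contract G v w i j =
  i ≢ j ×
  (Adj G (punchIn w i) (punchIn w j)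
   ⊎ (punchIn w i ≡ v × Adj G w (punchIn w j))
   ⊎ (punchIn w j ≡ v × Adj G w (punchIn w i)))

module Submission where

-- G/vw is 2-connected as soon as G - {v, w} is connected: deleting the merged vertex leaves
-- G - {v, w}, and deleting any other vertex x leaves the image of G - x.  If G - {v, w} is
-- disconnected for some w ∈ W(v), take u ∈ N(v) ∖ N[w] and let C be the union of the components
-- of G - {v, w} missing u.  A walk from C to v in G - w enters v from some x ∈ C; then x ∈ W(v),
-- since u ∉ N[x], and the components of G - {v, x} missing w lie inside C ∖ {x}.  These sets C
-- strictly decrease, so the descent stops at some w ∈ W(v) with G - {v, w} connected.

open import Defs hiding (sym)
open import Level using (0ℓ)
open import Data.Nat using (ℕ; suc; _≤_)
open import Data.Nat.Properties using (≤-pred)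
open import Data.Fin using (Fin; _≟_; punchIn; punchOut)
open import Data.Fin.Properties using (any?; ¬∀⟶∃¬; punchIn-punchOut; punchInᵢ≢i; punchIn-injective)
open import Data.Fin.Subset using (Subset; inside; _∈_; _∉_; _⊂_; _⊃_; _∪_; ⁅_⁆; Nonempty)
open import Data.Fin.Subset.Properties using (_∈?_; nonempty?; x∈⁅x⁆; x∈⁅y⁆⇒x≡y; x∈p∪q⁻; p⊆p∪q; q⊆p∪q)
open import Data.Fin.Subset.Induction using (⊂-wellFounded; ⊃-wellFounded)
open import Data.Vec using (tabulate)
open import Data.Vec.Properties using (lookup∘tabulate; []=⇒lookup; lookup⇒[]=)
open import Data.Product using (_×_; ∃; ∃₂; _,_; proj₁; proj₂)
open import Data.Sum using (_⊎_; inj₁; inj₂)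
open import Induction.WellFounded using (Acc; acc)
open import Relation.Nullary using (¬_; Dec; yes; no; does; contradiction)
open import Relation.Nullary.Decidable using (dec-true; decidable-stable; _×-dec_; _⊎-dec_; _→-dec_; ¬?)
open import Relation.Unary as U using (Pred)
open import Relation.Binary.Core using (Rel)
open import Relation.Binary.Definitions using (Decidable; Symmetric)
open import Relation.Binary.PropositionalEquality using (_≡_; _≢_; ≢-sym; refl; sym; trans; subst; subst₂)

module _ {n : ℕ} {R : Rel (Fin n) 0ℓ} {P : Pred (Fin n) 0ℓ} where

  head : ∀ {a b} → Walk R P a b → P a
  head [ pa ] = pa
  head ((pa , _) ∷ _) = pa

  last : ∀ {a b} → Walk R P a b → P b
  last [ pb ] = pb
  last (_ ∷ w) = last w

  infixr 5 _++_

  _++_ : ∀ {a b c} → Walk R P a b → Walk R P b c → Walk R P a c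
  [ _ ] ++ w′ = w′
  (s ∷ w) ++ w′ = s ∷ (w ++ w′)

  _∷ʳ_ : ∀ {a b c} → Walk R P a b → R b c × P c → Walk R P a c
  w ∷ʳ (r , pc) = w ++ ((last w , r) ∷ [ pc ])

  reverse : Symmetric R → ∀ {a b} → Walk R P a b → Walk R P b a
  reverse sym-R [ pa ] = [ pa ]
  reverse sym-R ((pa , r) ∷ w) = reverse sym-R w ∷ʳ (sym-R r , pa)

weaken : ∀ {n} {R : Rel (Fin n) 0ℓ} {P Q : Pred (Fin n) 0ℓ} →
         (∀ {y} → P y → Q y) → ∀ {a b} → Walk R P a b → Walk R Q a b
weaken P⇒Q [ pa ] = [ P⇒Q pa ]
weaken P⇒Q ((pa , r) ∷ w) = (P⇒Q pa , r) ∷ weaken P⇒Q w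

StepClosed : ∀ {n} → Rel (Fin n) 0ℓ → Pred (Fin n) 0ℓ → Subset n → Set
StepClosed R Q S = ∀ {x y} → x ∈ S → R x y → Q y → y ∈ S

module _ {n : ℕ} {R : Rel (Fin n) 0ℓ} {P : Pred (Fin n) 0ℓ} {S : Subset n} where

  walk-stays-in : StepClosed R P S → ∀ {a b} → Walk R P a b → a ∈ S → b ∈ S
  walk-stays-in closed [ _ ] a∈S = a∈S
  walk-stays-in closed ((_ , r) ∷ w) a∈S = walk-stays-in closed w (closed a∈S r (head w))

  leaving-edge : ∀ {a b} → Walk R P a b → a ∈ S → b ∉ S →
                 ∃₂ λ x y → x ∈ S × y ∉ S × R x y × P y
  leaving-edge [ _ ] a∈S b∉S = contradiction a∈S b∉S
  leaving-edge (_∷_ {x = y} (_ , r) w) a∈S b∉S with y ∈? S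
  ... | yes y∈S = leaving-edge w y∈S b∉S
  ... | no y∉S = _ , y , a∈S , y∉S , r , head w

  -- A walk from outside S that is cut at its first visit to b: before b every vertex lies in Q,
  -- so it cannot step into S without S pulling the previous vertex in as well.
  walk-avoiding : Symmetric R → ∀ {Q} → StepClosed R Q S → ∀ {b} → (∀ {y} → P y → y ≢ b → Q y) →
                  ∀ {a} → Walk R P a b → a ∉ S → Walk R (λ y → P y × y ∉ S) a b
  walk-avoiding sym-R closed P⇒Q [ pa ] a∉S = [ pa , a∉S ]
  walk-avoiding sym-R closed {b} P⇒Q {a} (_∷_ {x = y} (pa , r) w) a∉S with a ≟ b
  ... | yes refl = [ pa , a∉S ]
  ... | no a≢b = ((pa , a∉S) , r) ∷ walk-avoiding sym-R closed P⇒Q w y∉S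
    where
    y∉S : y ∉ S
    y∉S y∈S = a∉S (closed y∈S (sym-R r) (P⇒Q pa a≢b))

fromDec : ∀ {n} {P : Pred (Fin n) 0ℓ} → U.Decidable P → Subset n
fromDec P? = tabulate λ y → does (P? y)

module _ {n : ℕ} {P : Pred (Fin n) 0ℓ} (P? : U.Decidable P) where

  ∈-fromDec⁺ : ∀ {x} → P x → x ∈ fromDec P?
  ∈-fromDec⁺ {x} px = lookup⇒[]= x _ (trans (lookup∘tabulate _ x) (dec-true (P? x) px))

  ∈-fromDec⁻ : ∀ {x} → x ∈ fromDec P? → P x
  ∈-fromDec⁻ {x} x∈ = witness (P? x) (trans (sym (lookup∘tabulate _ x)) ([]=⇒lookup x∈))
    where
    witness : (d : Dec (P x)) → does d ≡ inside → P x
    witness (yes px) _ = px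

record Component {n} (R : Rel (Fin n) 0ℓ) (P : Pred (Fin n) 0ℓ) (a : Fin n) : Set where
  field
    members : Subset n
    source  : a ∈ members
    reaches : ∀ {b} → b ∈ members → Walk R P a b
    closed  : StepClosed R P members

record Detached {n} (R : Rel (Fin n) 0ℓ) (P : Pred (Fin n) 0ℓ) (r : Fin n) (C : Subset n) : Set where
  field
    within   : ∀ {y} → y ∈ C → P y
    closed   : StepClosed R P C
    r∉C      : r ∉ C
    nonempty : Nonempty C

module _ {n : ℕ} {R : Rel (Fin n) 0ℓ} (R? : Decidable R) {P : Pred (Fin n) 0ℓ} (P? : U.Decidable P) where

  saturate : ∀ {a} (S : Subset n) → Acc _⊃_ S → a ∈ S → (∀ {b} → b ∈ S → Walk R P a b) →
             Component R P a
  saturate S (acc larger) a∈S walks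
    with any? (λ b → any? λ c → b ∈? S ×-dec R? b c ×-dec P? c ×-dec ¬? (c ∈? S))
  ... | no no-exit = record { members = S ; source = a∈S ; reaches = walks ; closed = closed }
    where
    closed : StepClosed R P S
    closed {b} {c} b∈S r pc with c ∈? S
    ... | yes c∈S = c∈S
    ... | no c∉S = contradiction (b , c , b∈S , r , pc , c∉S) no-exit
  ... | yes (b , c , b∈S , r , pc , c∉S) =
    saturate (S ∪ ⁅ c ⁆) (larger (p⊆p∪q ⁅ c ⁆ , c , q⊆p∪q S ⁅ c ⁆ (x∈⁅x⁆ c) , c∉S))
             (p⊆p∪q ⁅ c ⁆ a∈S) walks′
    where
    walks′ : ∀ {y} → y ∈ S ∪ ⁅ c ⁆ → Walk _ _ _ y
    walks′ y∈ with x∈p∪q⁻ S ⁅ c ⁆ y∈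
    ... | inj₁ y∈S = walks y∈S
    ... | inj₂ y∈c with refl ← x∈⁅y⁆⇒x≡y c y∈c = walks b∈S ∷ʳ (r , pc)

  component : ∀ {a} → P a → Component R P a
  component {a} pa = saturate ⁅ a ⁆ (⊃-wellFounded _) (x∈⁅x⁆ a) λ b∈ → singleton (x∈⁅y⁆⇒x≡y a b∈)
    where
    singleton : ∀ {b} → b ≡ a → Walk R P a b
    singleton refl = [ pa ]

  module _ (sym-R : Symmetric R) {r : Fin n} (pr : P r) where
    private
      open Component (component pr)
      unreached? : U.Decidable λ y → P y × y ∉ members
      unreached? y = P? y ×-dec ¬? (y ∈? members)

      C : Subset n
      C = fromDec unreached?

      reached : ∀ {a} → P a → ¬ Nonempty C → a ∈ members
      reached {a} pa empty with a ∈? members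
      ... | yes a∈ = a∈
      ... | no a∉ = contradiction (a , ∈-fromDec⁺ unreached? (pa , a∉)) empty

      detached : Nonempty C → Detached R P r C
      detached nonempty = record
        { within   = λ y∈C → proj₁ (∈-fromDec⁻ unreached? y∈C)
        ; closed   = λ x∈C r py → ∈-fromDec⁺ unreached? (py , λ y∈ →
                       let px , x∉ = ∈-fromDec⁻ unreached? x∈C in x∉ (closed y∈ (sym-R r) px))
        ; r∉C      = λ r∈C → proj₂ (∈-fromDec⁻ unreached? r∈C) source
        ; nonempty = nonempty
        }

    connected-or-detached : ConnectedOn R P ⊎ ∃ (Detached R P r)
    connected-or-detached with nonempty? C
    ... | yes nonempty = inj₂ (C , detached nonempty)
    ... | no empty = inj₁ λ a b pa pb →
      reverse sym-R (reaches (reached pa empty)) ++ reaches (reached pb empty)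

module Contraction {m : ℕ} (G : SimpleGraph (suc m)) {v w : Fin (suc m)} (v≢w : v ≢ w) where

  merge : Fin (suc m) → Fin (suc m)
  merge y with y ≟ w
  ... | yes _ = v
  ... | no _ = y

  w≢merge : ∀ y → w ≢ merge y
  w≢merge y with y ≟ w
  ... | yes _ = λ w≡v → v≢w (sym w≡v)
  ... | no y≢w = λ w≡y → y≢w (sym w≡y)

  merge-≢ : ∀ {y} → y ≢ w → merge y ≡ y
  merge-≢ {y} y≢w with y ≟ w
  ... | yes y≡w = contradiction y≡w y≢w
  ... | no _ = refl

  contract : Fin (suc m) → Fin m
  contract y = punchOut (w≢merge y)

  punchIn-contract : ∀ y → punchIn w (contract y) ≡ merge y
  punchIn-contract y = punchIn-punchOut (w≢merge y)

  contract-punchIn : ∀ i → contract (punchIn w i) ≡ i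
  contract-punchIn i = punchIn-injective w _ i
    (trans (punchIn-contract (punchIn w i)) (merge-≢ (punchInᵢ≢i w i)))

  contract-≡ : ∀ {y i} → contract y ≡ i → merge y ≡ punchIn w i
  contract-≡ {y} refl = sym (punchIn-contract y)

  merged-adj : ∀ {a b} → Adj G a b →
               Adj G (merge a) (merge b) ⊎ (merge a ≡ v × Adj G w (merge b))
                                         ⊎ (merge b ≡ v × Adj G w (merge a))
  merged-adj {a} {b} r with a ≟ w | b ≟ w
  ... | yes refl | yes refl = contradiction r (irrefl G refl)
  ... | yes refl | no _     = inj₂ (inj₁ (refl , r))
  ... | no _     | yes refl = inj₂ (inj₂ (refl , SimpleGraph.sym G r))
  ... | no _     | no _     = inj₁ r

  contract-adj : ∀ {a b} → Adj G a b → contract a ≢ contract b →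
                 Contract G v w (contract a) (contract b)
  contract-adj {a} {b} r ca≢cb = ca≢cb ,
    subst₂ (λ x y → Adj G x y ⊎ (x ≡ v × Adj G w y) ⊎ (y ≡ v × Adj G w x))
           (sym (punchIn-contract a)) (sym (punchIn-contract b)) (merged-adj r)

  -- The step along the contracted edge vw collapses to a single vertex and is dropped.
  contract-walk : ∀ {P Q} → (∀ {y} → P y → Q (contract y)) →
                  ∀ {a b} → Walk (Adj G) P a b → Walk (Contract G v w) Q (contract a) (contract b)
  contract-walk P⇒Q [ pa ] = [ P⇒Q pa ]
  contract-walk P⇒Q {a} (_∷_ {x = x} (pa , r) rest) with contract a ≟ contract x
  ... | yes ca≡cx rewrite ca≡cx = contract-walk P⇒Q rest
  ... | no ca≢cx = (P⇒Q pa , contract-adj r ca≢cx) ∷ contract-walk P⇒Q rest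

  contract-connected : ∀ {P Q} → ConnectedOn (Adj G) P →
                       (∀ {y} → P y → Q (contract y)) → (∀ {i} → Q i → P (punchIn w i)) →
                       ConnectedOn (Contract G v w) Q
  contract-connected conn P⇒Q Q⇒P i j qi qj =
    subst₂ (Walk (Contract G v w) _) (contract-punchIn i) (contract-punchIn j)
           (contract-walk P⇒Q (conn _ _ (Q⇒P qi) (Q⇒P qj)))

  contract-2-connected : 4 ≤ suc m → TwoConnected (Adj G) →
                         ConnectedOn (Adj G) (λ y → y ≢ v × y ≢ w) → TwoConnected (Contract G v w)
  contract-2-connected 4≤n (_ , G-x-connected) G-vw-connected =
    ≤-pred 4≤n , λ x → deleting x (punchIn w x ≟ v)
    where
    deleting : ∀ x → Dec (punchIn w x ≡ v) → ConnectedOn (Contract G v w) (λ i → i ≢ x)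
    deleting x (yes x≡v) = contract-connected G-vw-connected kept lifted
      where
      kept : ∀ {y} → y ≢ v × y ≢ w → contract y ≢ x
      kept {y} (y≢v , y≢w) cy≡x = y≢v (trans (sym (merge-≢ y≢w)) (trans (contract-≡ {y} cy≡x) x≡v))
      lifted : ∀ {i} → i ≢ x → punchIn w i ≢ v × punchIn w i ≢ w
      lifted {i} i≢x = (λ i≡v → i≢x (punchIn-injective w i x (trans i≡v (sym x≡v))))
                     , punchInᵢ≢i w i
    deleting x (no x≢v) = contract-connected (G-x-connected (punchIn w x)) kept lifted
      where
      kept : ∀ {y} → y ≢ punchIn w x → contract y ≢ x
      kept {y} y≢x cy≡x with y ≟ w | contract-≡ {y} cy≡x
      ... | yes _ | v≡x = x≢v (sym v≡x)
      ... | no _  | y≡x = y≢x y≡x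
      lifted : ∀ {i} → i ≢ x → punchIn w i ≢ punchIn w x
      lifted {i} i≢x i≡x = i≢x (punchIn-injective w i x i≡x)

adj⇒≢ : ∀ {n} (G : SimpleGraph n) {x y} → Adj G x y → x ≢ y
adj⇒≢ G x∼y x≡y = irrefl G x≡y x∼y

N[_]? : ∀ {n} (G : SimpleGraph n) → ∀ x y → Dec (N[ G ] x y)
N[ G ]? x y = (y ≟ x) ⊎-dec adj? G x y

private-neighbour : ∀ {n} (G : SimpleGraph n) {v w} → InW G v w → ∃ λ u → Adj G v u × ¬ N[ G ] w u
private-neighbour G {v} {w} (v∼w , N[v]⊈N[w])
  with u , ¬N[v]⇒N[w] ← ¬∀⟶∃¬ _ _ (λ y → N[ G ]? v y →-dec N[ G ]? w y) N[v]⊈N[w]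
  = u , adjacent u∈N[v] , u∉N[w]
  where
  u∈N[v] : N[ G ] v u
  u∈N[v] = decidable-stable (N[ G ]? v u) λ u∉N[v] →
    ¬N[v]⇒N[w] λ u∈N[v] → contradiction u∈N[v] u∉N[v]
  u∉N[w] : ¬ N[ G ] w u
  u∉N[w] u∈N[w] = ¬N[v]⇒N[w] λ _ → u∈N[w]
  adjacent : N[ G ] v u → Adj G v u
  adjacent (inj₁ refl) = contradiction (inj₂ (SimpleGraph.sym G v∼w)) u∉N[w]
  adjacent (inj₂ v∼u) = v∼u

module Descent {m : ℕ} (G : SimpleGraph (suc m)) (4≤n : 4 ≤ suc m) (2-connected : TwoConnected (Adj G))
               (v : Fin (suc m)) where

  Avoids : Fin (suc m) → Pred (Fin (suc m)) 0ℓ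
  Avoids w y = y ≢ v × y ≢ w

  avoids? : ∀ w → U.Decidable (Avoids w)
  avoids? w y = ¬? (y ≟ v) ×-dec ¬? (y ≟ w)

  Contractible : Fin (suc m) → Set
  Contractible w = InW G v w × TwoConnected (Contract G v w)

  -- C is a union of components of G - {v, w} that misses the neighbour u of v.
  record Side (w u : Fin (suc m)) (C : Subset (suc m)) : Set where
    field
      v∼w      : Adj G v w
      v∼u      : Adj G v u
      u≢w      : u ≢ w
      detached : Detached (Adj G) (Avoids w) u C
    open Detached detached public

  contractible-or-side : ∀ {w u} → InW G v w → Adj G v u → u ≢ w → Contractible w ⊎ ∃ (Side w u)
  contractible-or-side {w} w∈W@(v∼w , _) v∼u u≢w
    with connected-or-detached (adj? G) (avoids? w) (SimpleGraph.sym G) (≢-sym (adj⇒≢ G v∼u) , u≢w)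
  ... | inj₁ G-vw-connected =
    inj₁ (w∈W , Contraction.contract-2-connected G (adj⇒≢ G v∼w) 4≤n 2-connected G-vw-connected)
  ... | inj₂ (C , detached) = inj₂ (C , record { v∼w = v∼w ; v∼u = v∼u ; u≢w = u≢w ; detached = detached })

  module _ {w u C} (side : Side w u C) where
    open Side side

    private
      v≢w : v ≢ w
      v≢w = adj⇒≢ G v∼w

      v∉C : v ∉ C
      v∉C v∈C = proj₁ (within v∈C) refl

      x∈C⇒w≢x : ∀ {x} → x ∈ C → w ≢ x
      x∈C⇒w≢x x∈C w≡x = proj₂ (within x∈C) (sym w≡x)

    neighbour-in-side : ∃ λ x → x ∈ C × Adj G v x
    neighbour-in-side
      with c , c∈C ← nonempty
      with x , y , x∈C , y∉C , x∼y , y≢w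
             ← leaving-edge (proj₂ 2-connected w c v (proj₂ (within c∈C)) v≢w) c∈C v∉C
      with y ≟ v
    ... | yes refl = x , x∈C , SimpleGraph.sym G x∼y
    ... | no y≢v = contradiction (closed x∈C x∼y (y≢v , y≢w)) y∉C

    side-neighbour-in-W : ∀ {x} → x ∈ C → Adj G v x → InW G v x
    side-neighbour-in-W {x} x∈C v∼x = v∼x , λ N[v]⊆N[x] → u∉N[x] (N[v]⊆N[x] u (inj₂ v∼u))
      where
      u∉N[x] : ¬ N[ G ] x u
      u∉N[x] (inj₁ refl) = r∉C x∈C
      u∉N[x] (inj₂ x∼u) = r∉C (closed x∈C x∼u (≢-sym (adj⇒≢ G v∼u) , u≢w))

    -- A vertex of C′ outside C would reach w in G - v without entering C, hence avoiding x.
    side-shrinks : ∀ {x C′} → x ∈ C → Side x w C′ → C′ ⊂ C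
    side-shrinks {x} {C′} x∈C side′ = C′⊆C , x , x∈C , λ x∈C′ → proj₂ (Side.within side′ x∈C′) refl
      where
      C′⊆C : ∀ {z} → z ∈ C′ → z ∈ C
      C′⊆C {z} z∈C′ with z ∈? C
      ... | yes z∈C = z∈C
      ... | no z∉C = contradiction (walk-stays-in (Side.closed side′) to-w z∈C′) (Side.r∉C side′)
        where
        avoiding-C : Walk (Adj G) (λ y → y ≢ v × y ∉ C) z w
        avoiding-C = walk-avoiding (SimpleGraph.sym G) closed _,_
          (proj₂ 2-connected v z w (proj₁ (Side.within side′ z∈C′)) (≢-sym v≢w)) z∉C
        to-w : Walk (Adj G) (Avoids x) z w
        to-w = weaken (λ (y≢v , y∉C) → y≢v , λ y≡x → y∉C (subst (_∈ C) (sym y≡x) x∈C)) avoiding-C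

    shrink : ∃ Contractible ⊎ ∃₂ λ x C′ → Side x w C′ × C′ ⊂ C
    shrink
      with x , x∈C , v∼x ← neighbour-in-side
      with contractible-or-side (side-neighbour-in-W x∈C v∼x) v∼w (x∈C⇒w≢x x∈C)
    ... | inj₁ x-contractible = inj₁ (x , x-contractible)
    ... | inj₂ (C′ , side′) = inj₂ (x , C′ , side′ , side-shrinks x∈C side′)

  descend : ∀ C → Acc _⊂_ C → ∀ {w u} → Side w u C → ∃ Contractible
  descend C (acc smaller) side with shrink side
  ... | inj₁ found = found
  ... | inj₂ (_ , C′ , side′ , C′⊂C) = descend C′ (smaller C′⊂C) side′

lemma3p1 : (m : ℕ) → (G : SimpleGraph (suc m)) → 4 ≤ suc m → TwoConnected (Adj G)
    → (v : Fin (suc m)) → ∃ (λ w → InW G v w)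
    → ∃ (λ w → InW G v w × TwoConnected (Contract G v w))
lemma3p1 m G 4≤n 2-connected v (w , w∈W) = start (private-neighbour G w∈W)
  where
  open Descent G 4≤n 2-connected v
  start : (∃ λ u → Adj G v u × ¬ N[ G ] w u) → ∃ Contractible
  start (u , v∼u , u∉N[w]) with contractible-or-side w∈W v∼u (λ u≡w → u∉N[w] (inj₁ u≡w))
  ... | inj₁ w-contractible = w , w-contractible
  ... | inj₂ (C , side) = descend C (⊂-wellFounded C) side
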